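{- Let $n\ge 2$. Consider the $2^n-1$ labels of the nodes at addresses $v\in A^*$ with $|v|\le n-1$ in the V$_{10}$ tree, linearized in in-order (symmetric) order, i.e. starting from the root and, for $l=1,\dots,n-1$, placing the $2^l-1$ labels of addresses of length $<l$ between the $2^l$ labels of addresses of length $l$ (left subtree, node, right subtree). Let $p_k/q_k$ (in lowest terms, $q_k>0$) be the $k$-th entry of this linearized sequence, $1\le k\le 2^n-1$. For $2\le k\le 2^n-2$ let $\Delta^+=p_{k+1}q_k-p_kq_{k+1}$, $\Delta^-=p_kq_{k-1}-p_{k-1}q_k$, $g=\gcd(\Delta^+,\Delta^-)$, $\Delta_+=\Delta^+/g$, $\Delta_-=\Delta^-/g$. Then $$\frac{p_k}{q_k}=\frac{\Delta_+\,p_{k-1}+\Delta_-\,p_{k+1}}{\Delta_+\,q_{k-1}+\Delta_-\,q_{k+1}}.$$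
   Context: $A=\{0,1\}$, $A^*$ finite binary words, $\overline{w}$ bitwise complement. For $b\in\mathbb{N}$ with binary expansion $b=\sum_{k=0}^l b_k2^k$, $l=\lfloor\log_2 b\rfloor$, $C_I(b)=0^l\,1\,\overline{b_{l-1}}\cdots\overline{b_0}$, $C_{II}(b)=\overline{C_I(b)}$, $C_I(\aleph_0)=0^\omega$ (complete prefix-free codes). The V$_{10}$ tree is the infinite binary tree whose node at address $v\in A^*$ (root $\varepsilon$, left child $v0$, right child $v1$) carries the label $?_V^{ -1}(v)\in\mathbb{Q}\cap(0,1)$, defined as follows: decompose $v\,1\,0^\omega$ uniquely as $C_I(b_1)C_{II}(b_2)\cdots C_I(b_{2l-1})C_{II}(b_{2l})C_I(\aleph_0)$ and let $?_V^{ -1}(v)$ be the continued fraction $[b_1,\dots,b_{2l}]=\cfrac{1}{b_1+\cfrac{1}{\ddots+\cfrac{1}{b_{2l}}}}$. -}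

module Defs where

open import Data.Bool using (Bool; true; false; not; if_then_else_; _∧_)
open import Data.Nat as ℕ using (ℕ; zero; suc; _+_; _*_; _∸_; _^_)
open import Data.List using (List; []; _∷_; _++_; map; length)
open import Data.Product using (_×_; _,_)
open import Data.Integer as ℤ using (ℤ; +_)
open import Data.Integer.GCD as ℤG using ()
open import Data.Rational as ℚ using (ℚ; normalize; 0ℚ)

-- Binary words.  A = Bool with 0 = false, 1 = true.
-- A finite list w stands for the infinite word w 0^ω (implicit trailing
-- zeros); hd/tl read that infinite word.

Word : Set
Word = List Bool

hd : Word → Bool
hd []      = false
hd (b ∷ _) = b

tl : Word → Word
tl []      = []
tl (_ ∷ w) = w

allZero : Word → Bool
allZero []          = true
allZero (true ∷ _)  = false
allZero (false ∷ w) = allZero w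

countLeading : Bool → Word → ℕ × Word
countLeading c [] = 0 , []
countLeading true  (true ∷ w)  with countLeading true w
... | l , r = suc l , r
countLeading true  (false ∷ w) = 0 , false ∷ w
countLeading false (false ∷ w) with countLeading false w
... | l , r = suc l , r
countLeading false (true ∷ w)  = 0 , true ∷ w

readBits : Bool → ℕ → Word → ℕ × Word
readBits cmp zero    w = 0 , w
readBits cmp (suc l) w with readBits cmp l (tl w)
... | x , r = (if (if cmp then not (hd w) else hd w) then 2 ^ l else 0) + x , r

-- Decoding  w 0^ω = C_I(b1) C_II(b2) ... C_I(b_{2l-1}) C_II(b_{2l}) C_I(ℵ0).
-- C_I(b)  = 0^l 1 (complement of the l low bits of b),  b = 2^l + low bits
-- C_II(b) = 1^l 0 (the l low bits of b)
-- parseI / parseII parse a C_I- resp. C_II-code; fuel bounds the number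
-- of codes (length w + 2 always suffices).

mutual
  parseI : ℕ → Word → List ℕ
  parseI zero    w = []
  parseI (suc f) w with allZero w
  ... | true  = []            -- C_I(ℵ0) = 0^ω : end of the decomposition
  ... | false with countLeading false w
  ...   | l , w₁ with readBits true l (tl w₁)
  ...     | x , w₂ = (2 ^ l + x) ∷ parseII f w₂

  parseII : ℕ → Word → List ℕ
  parseII zero    w = []
  parseII (suc f) w with countLeading true w
  ... | l , w₁ with readBits false l (tl w₁)
  ...   | x , w₂ = (2 ^ l + x) ∷ parseI f w₂

-- the partial quotients (b1, ..., b_{2l}) of the node at address v:
-- decompose v 1 0^ω
quotients : Word → List ℕ
quotients v = parseI (length (v ++ true ∷ []) + 2) (v ++ true ∷ [])

-- Continued fraction [b1,...,bm] = 1/(b1 + 1/(... + 1/bm)) as a pair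
-- (numerator , denominator) of naturals; [] ↦ 0/1.

cfPair : List ℕ → ℕ × ℕ
cfPair []       = 0 , 1
cfPair (b ∷ bs) with cfPair bs
... | p , q = q , b * q + p

-- p/q as an element of ℚ (reduced).  The denominator 0 never occurs for
-- partial quotients ≥ 1; 0ℚ is junk for that unreachable case.
fracℚ : ℕ → ℕ → ℚ
fracℚ p zero    = 0ℚ
fracℚ p (suc q) = normalize p (suc q)

cfℚ : List ℕ → ℚ
cfℚ bs with cfPair bs
... | p , q = fracℚ p q

label : Word → ℚ
label v = cfℚ (quotients v)

inorder : ℕ → List Word
inorder zero    = [] ∷ []
inorder (suc m) = map (false ∷_) (inorder m) ++ ([] ∷ []) ++ map (true ∷_) (inorder m)

labelSeq : ℕ → List ℚ
labelSeq n = map label (inorder (n ∸ 1))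

-- k-th entry, 1-indexed (0ℚ outside the range 1 ≤ k ≤ length)
nth1 : List ℚ → ℕ → ℚ
nth1 []       _             = 0ℚ
nth1 (x ∷ xs) zero          = 0ℚ
nth1 (x ∷ xs) (suc zero)    = x
nth1 (x ∷ xs) (suc (suc k)) = nth1 xs (suc k)

pk : ℕ → ℕ → ℤ
pk n k = ℚ.↥ (nth1 (labelSeq n) k)

qk : ℕ → ℕ → ℤ
qk n k = ℚ.↧ (nth1 (labelSeq n) k)

-- exact integer division a / g (g ≥ 0 here); junk 0 when g = 0
divℤ : ℤ → ℤ → ℤ
divℤ a (+ suc m) = a ℤ./ (+ suc m)
divℤ a _         = + 0

Δ⁺ Δ⁻ g Δ₊ Δ₋ : ℕ → ℕ → ℤ
Δ⁺ n k = pk n (suc k) ℤ.* qk n k ℤ.- pk n k ℤ.* qk n (suc k)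
Δ⁻ n k = pk n k ℤ.* qk n (k ∸ 1) ℤ.- pk n (k ∸ 1) ℤ.* qk n k
g  n k = ℤG.gcd (Δ⁺ n k) (Δ⁻ n k)
Δ₊ n k = divℤ (Δ⁺ n k) (g n k)
Δ₋ n k = divℤ (Δ⁻ n k) (g n k)

module Submission where

-- For an address v write v⁺ = v 1 0^ω.  The proof rests on one fact: the
-- labelling of the V₁₀ tree is order preserving, i.e. if u⁺ is
-- lexicographically below w⁺ then the label of u is below the label of w.
-- A C_I code read from a larger word codes a smaller partial quotient (its
-- run of zeros is shorter, or equally long with smaller complemented bits),
-- a C_II code a larger one; and 1/(b + t) decreases in b (the tails t lie
-- in [0,1) resp. (0,1]) and, for equal b, in t.  Hence C_I decodings grow
-- and C_II decodings shrink along the lexicographic order (a joint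
-- induction), and so do the labels.  The in-order listing of the addresses
-- is lexicographically sorted, so p_{k-1}/q_{k-1} < p_k/q_k < p_{k+1}/q_{k+1}.
-- Then Δ⁺, Δ⁻ > 0, hence Δ₊, Δ₋ > 0, and the identity
--   p_k (Δ₊ q_{k-1} + Δ₋ q_{k+1}) - q_k (Δ₊ p_{k-1} + Δ₋ p_{k+1}) = Δ₊ Δ⁻ - Δ₋ Δ⁺ = 0
-- proves the theorem.

open import Defs

module Lexicographic where

  open import Data.Bool using (Bool; true; false; not; if_then_else_)
  open import Data.Nat using (ℕ; zero; suc; _+_; _^_; _<_; z≤n; s≤s)
  open import Data.Nat.Properties using (+-monoʳ-<; <-≤-trans; m≤m+n; +-identityʳ; ^-monoʳ-≤; module ≤-Reasoning)
  open import Data.List using ([]; _∷_)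
  open import Data.Product using (_×_; _,_; proj₁; proj₂)
  open import Data.Sum using (_⊎_; inj₁; inj₂)
  open import Relation.Binary.PropositionalEquality using (_≡_; refl; sym; trans; cong)

  infix 4 _≺_

  data _≺_ : Word → Word → Set where
    here  : ∀ {x y} → hd x ≡ false → hd y ≡ true → x ≺ y
    there : ∀ {x y} → hd x ≡ hd y → tl x ≺ tl y → x ≺ y

  ≺-nonzero : ∀ {x y} → x ≺ y → allZero y ≡ false
  ≺-nonzero {y = []}        (here _ ())
  ≺-nonzero {y = []}        (there _ x≺y) = ≺-nonzero x≺y
  ≺-nonzero {y = true ∷ _}  _             = refl
  ≺-nonzero {y = false ∷ _} (here _ ())
  ≺-nonzero {y = false ∷ _} (there _ x≺y) = ≺-nonzero x≺y

  ≺-tail : ∀ {x y} → hd x ≡ hd y → x ≺ y → tl x ≺ tl y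
  ≺-tail same (here x₀ y₁) with () ← trans (sym x₀) (trans same y₁)
  ≺-tail _    (there _ t)  = t

  -- Outcome of reading a number m from x and n from y when x ≺ y: either
  -- the numbers already differ in the stated direction, or they agree and
  -- the unread remainders r, s are still ordered.
  Ascending Descending : ℕ → ℕ → Word → Word → Set
  Ascending  m n r s = m < n ⊎ (m ≡ n × r ≺ s)
  Descending m n r s = n < m ⊎ (m ≡ n × r ≺ s)

  ascending-shift : ∀ c {m n r s} → Ascending m n r s → Ascending (c + m) (c + n) r s
  ascending-shift c (inj₁ m<n)        = inj₁ (+-monoʳ-< c m<n)
  ascending-shift c (inj₂ (m≡n , r≺s)) = inj₂ (cong (c +_) m≡n , r≺s)

  descending-shift : ∀ c {m n r s} → Descending m n r s → Descending (c + m) (c + n) r s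
  descending-shift c (inj₁ n<m)        = inj₁ (+-monoʳ-< c n<m)
  descending-shift c (inj₂ (m≡n , r≺s)) = inj₂ (cong (c +_) m≡n , r≺s)

  zeros ones : Word → ℕ
  zeros w = proj₁ (countLeading false w)
  ones  w = proj₁ (countLeading true w)

  afterZeros afterOnes : Word → Word
  afterZeros w = proj₂ (countLeading false w)
  afterOnes  w = proj₂ (countLeading true w)

  afterZeros-hd : ∀ w → allZero w ≡ false → hd (afterZeros w) ≡ true
  afterZeros-hd []          ()
  afterZeros-hd (true ∷ w)  _  = refl
  afterZeros-hd (false ∷ w) nz = afterZeros-hd w nz

  afterOnes-hd : ∀ w → hd (afterOnes w) ≡ false
  afterOnes-hd []          = refl
  afterOnes-hd (true ∷ w)  = afterOnes-hd w
  afterOnes-hd (false ∷ w) = refl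

  zeros-descending : ∀ {x y} → allZero x ≡ false → x ≺ y →
    Descending (zeros x) (zeros y) (afterZeros x) (afterZeros y)
  zeros-descending {[]} () _
  zeros-descending {true ∷ _}  {[]}        _ (here _ ())
  zeros-descending {true ∷ _}  {[]}        _ (there () _)
  zeros-descending {true ∷ _}  {true ∷ _}  _ x≺y = inj₂ (refl , x≺y)
  zeros-descending {true ∷ _}  {false ∷ _} _ (here () _)
  zeros-descending {true ∷ _}  {false ∷ _} _ (there () _)
  zeros-descending {false ∷ _} {[]}        _ (here _ ())
  zeros-descending {false ∷ _} {[]}        _ (there _ x≺0) with () ← ≺-nonzero x≺0
  zeros-descending {false ∷ _} {true ∷ _}  _ _ = inj₁ (s≤s z≤n)
  zeros-descending {false ∷ _} {false ∷ _} _ (here _ ())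
  zeros-descending {false ∷ _} {false ∷ _} nz (there _ x≺y) =
    descending-shift 1 (zeros-descending nz x≺y)

  ones-ascending : ∀ {x y} → x ≺ y → Ascending (ones x) (ones y) (afterOnes x) (afterOnes y)
  ones-ascending {[]}        {[]}        x≺y = inj₂ (refl , x≺y)
  ones-ascending {[]}        {true ∷ _}  _   = inj₁ (s≤s z≤n)
  ones-ascending {[]}        {false ∷ _} x≺y = inj₂ (refl , x≺y)
  ones-ascending {false ∷ _} {[]}        x≺y = inj₂ (refl , x≺y)
  ones-ascending {false ∷ _} {true ∷ _}  _   = inj₁ (s≤s z≤n)
  ones-ascending {false ∷ _} {false ∷ _} x≺y = inj₂ (refl , x≺y)
  ones-ascending {true ∷ _}  {[]}        (here () _)
  ones-ascending {true ∷ _}  {[]}        (there () _)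
  ones-ascending {true ∷ _}  {false ∷ _} (here () _)
  ones-ascending {true ∷ _}  {false ∷ _} (there () _)
  ones-ascending {true ∷ _}  {true ∷ _}  (here () _)
  ones-ascending {true ∷ _}  {true ∷ _}  (there _ x≺y) = ascending-shift 1 (ones-ascending x≺y)

  bits : Bool → ℕ → Word → ℕ
  bits c l w = proj₁ (readBits c l w)

  afterBits : Bool → ℕ → Word → Word
  afterBits c l w = proj₂ (readBits c l w)

  bits-bound : ∀ c l w → bits c l w < 2 ^ l
  bits-bound c zero    w = s≤s z≤n
  bits-bound c (suc l) w with (if c then not (hd w) else hd w)
  ... | true  = +-monoʳ-< (2 ^ l) (<-≤-trans (bits-bound c l (tl w)) (m≤m+n (2 ^ l) 0))
  ... | false = <-≤-trans (bits-bound c l (tl w)) (m≤m+n (2 ^ l) (2 ^ l + 0))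

  bits-ascending : ∀ l {x y} → x ≺ y →
    Ascending (bits false l x) (bits false l y) (afterBits false l x) (afterBits false l y)
  bits-ascending zero x≺y = inj₂ (refl , x≺y)
  bits-ascending (suc l) {x} (here x₀ y₁) rewrite x₀ | y₁ =
    inj₁ (<-≤-trans (bits-bound false l (tl x)) (m≤m+n (2 ^ l) _))
  bits-ascending (suc l) (there same t) rewrite same = ascending-shift _ (bits-ascending l t)

  complementedBits-descending : ∀ l {x y} → x ≺ y →
    Descending (bits true l x) (bits true l y) (afterBits true l x) (afterBits true l y)
  complementedBits-descending zero x≺y = inj₂ (refl , x≺y)
  complementedBits-descending (suc l) {y = y} (here x₀ y₁) rewrite x₀ | y₁ =
    inj₁ (<-≤-trans (bits-bound true l (tl y)) (m≤m+n (2 ^ l) _))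
  complementedBits-descending (suc l) (there same t) rewrite same =
    descending-shift _ (complementedBits-descending l t)

  -- The partial quotient b = 2^l + (low bits) coded by the C_I code
  -- 0^l 1 (complemented bits) resp. the C_II code 1^l 0 (bits) at the front
  -- of w, and the rest of w after the code.
  valueI valueII : Word → ℕ
  valueI  w = 2 ^ zeros w + bits true (zeros w) (tl (afterZeros w))
  valueII w = 2 ^ ones w + bits false (ones w) (tl (afterOnes w))

  restI restII : Word → Word
  restI  w = afterBits true (zeros w) (tl (afterZeros w))
  restII w = afterBits false (ones w) (tl (afterOnes w))

  longer-code-larger : ∀ {l l' v} v' → l < l' → v < 2 ^ l → 2 ^ l + v < 2 ^ l' + v'
  longer-code-larger {l} {l'} {v} v' l<l' v<2ˡ = begin-strict
    2 ^ l + v       <⟨ +-monoʳ-< (2 ^ l) v<2ˡ ⟩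
    2 ^ l + 2 ^ l   ≡⟨ cong (2 ^ l +_) (sym (+-identityʳ (2 ^ l))) ⟩
    2 ^ suc l       ≤⟨ ^-monoʳ-≤ 2 l<l' ⟩
    2 ^ l'          ≤⟨ m≤m+n (2 ^ l') v' ⟩
    2 ^ l' + v'     ∎
    where open ≤-Reasoning

  sameExponentI : ∀ {l l' x y} → l ≡ l' → x ≺ y →
    Descending (2 ^ l + bits true l x) (2 ^ l' + bits true l' y) (afterBits true l x) (afterBits true l' y)
  sameExponentI {l} refl x≺y = descending-shift (2 ^ l) (complementedBits-descending l x≺y)

  sameExponentII : ∀ {l l' x y} → l ≡ l' → x ≺ y →
    Ascending (2 ^ l + bits false l x) (2 ^ l' + bits false l' y) (afterBits false l x) (afterBits false l' y)
  sameExponentII {l} refl x≺y = ascending-shift (2 ^ l) (bits-ascending l x≺y)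

  valueI-descending : ∀ {x y} → allZero x ≡ false → x ≺ y →
    Descending (valueI x) (valueI y) (restI x) (restI y)
  valueI-descending {x} {y} nz x≺y with zeros-descending nz x≺y
  ... | inj₁ shorter = inj₁ (longer-code-larger _ shorter (bits-bound true (zeros y) _))
  ... | inj₂ (same , rest≺) = sameExponentI same (≺-tail oneAfterZeros rest≺)
    where
    oneAfterZeros : hd (afterZeros x) ≡ hd (afterZeros y)
    oneAfterZeros = trans (afterZeros-hd x nz) (sym (afterZeros-hd y (≺-nonzero x≺y)))

  valueII-ascending : ∀ {x y} → x ≺ y → Ascending (valueII x) (valueII y) (restII x) (restII y)
  valueII-ascending {x} {y} x≺y with ones-ascending x≺y
  ... | inj₁ shorter = inj₁ (longer-code-larger _ shorter (bits-bound false (ones x) _))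
  ... | inj₂ (same , rest≺) =
    sameExponentII same (≺-tail (trans (afterOnes-hd x) (sym (afterOnes-hd y))) rest≺)

module ContinuedFractionStep where

  open import Data.Nat using (ℕ; suc; _+_; _*_; _≤_; _<_; z<s)
  open import Data.Nat.Properties
    using (≤-trans; *-comm; +-monoʳ-<; +-monoʳ-≤; *-monoˡ-≤; *-monoʳ-≤; *-monoʳ-<; m≤m+n; m<m+n; module ≤-Reasoning)
  open import Data.Nat.Tactic.RingSolver using (solve-∀)
  open import Data.Product using (_×_; _,_; proj₁; proj₂)
  open import Relation.Binary.PropositionalEquality using (_≡_; sym; cong)

  Frac : Set
  Frac = ℕ × ℕ

  infix 4 _<F_

  _<F_ : Frac → Frac → Set
  x <F y = proj₁ x * proj₂ y < proj₁ y * proj₂ x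

  Proper InUnit : Frac → Set
  Proper x = proj₁ x < proj₂ x
  InUnit x = 0 < proj₁ x × proj₁ x ≤ proj₂ x

  -- One continued-fraction step t ↦ 1/(b + t); cfPair (b ∷ bs) is,
  -- definitionally, step b (cfPair bs).
  step : ℕ → Frac → Frac
  step b x = proj₂ x , b * proj₂ x + proj₁ x

  step-proper : ∀ {b} x → 1 ≤ b → 0 < proj₁ x → Proper (step b x)
  step-proper {suc b} (p , q) _ p>0 = begin-strict
    q                   <⟨ m<m+n q p>0 ⟩
    q + p               ≤⟨ +-monoʳ-≤ q (m≤m+n p (b * q)) ⟩
    q + (p + b * q)     ≡⟨ rearrange q p b ⟩
    suc b * q + p       ∎
    where
    open ≤-Reasoning
    rearrange : ∀ q p b → q + (p + b * q) ≡ suc b * q + p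
    rearrange = solve-∀

  step-atMostOne : ∀ {b} x → 1 ≤ b → proj₁ (step b x) ≤ proj₂ (step b x)
  step-atMostOne {suc b} (p , q) _ = ≤-trans (m≤m+n q (b * q)) (m≤m+n (suc b * q) p)

  expand : ∀ q r b p → q * (b * r + p) ≡ b * (q * r) + p * q
  expand = solve-∀

  step-antitone : ∀ b {x y} → x <F y → step b y <F step b x
  step-antitone b {px , qx} {py , qy} x<y = begin-strict
    qy * (b * qx + px)      ≡⟨ expand qy qx b px ⟩
    b * (qy * qx) + px * qy <⟨ +-monoʳ-< (b * (qy * qx)) x<y ⟩
    b * (qy * qx) + py * qx ≡⟨ cong (λ t → b * t + py * qx) (*-comm qy qx) ⟩
    b * (qx * qy) + py * qx ≡⟨ sym (expand qx qy b py) ⟩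
    qx * (b * qy + py)      ∎
    where open ≤-Reasoning

  expand-unit : ∀ q' b q → q' * (b * q + q) ≡ suc b * (q * q')
  expand-unit = solve-∀

  -- A larger partial quotient b' gives a smaller value 1/(b' + t'), provided
  -- b + t < b' + t': here because t ≤ 1 and t' > 0 ...
  larger-quotient-smaller : ∀ {b b' x x'} → b < b' → 0 < proj₁ x' → InUnit x → step b' x' <F step b x
  larger-quotient-smaller {b} {b'} {p , suc q} {suc p' , q'} b<b' z<s (z<s , p≤q) = begin-strict
    q' * (b * Q + p)        ≤⟨ *-monoʳ-≤ q' (+-monoʳ-≤ (b * Q) p≤q) ⟩
    q' * (b * Q + Q)        ≡⟨ expand-unit q' b Q ⟩
    suc b * (Q * q')        ≤⟨ *-monoˡ-≤ (Q * q') b<b' ⟩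
    b' * (Q * q')           <⟨ m<m+n (b' * (Q * q')) z<s ⟩
    b' * (Q * q') + P' * Q  ≡⟨ sym (expand Q q' b' P') ⟩
    Q * (b' * q' + P')      ∎
    where
    open ≤-Reasoning
    Q P' : ℕ
    Q  = suc q
    P' = suc p'

  -- ... or because t < 1 and t' ≥ 0 (with a positive denominator).
  larger-quotient-smaller′ : ∀ {b b' x x'} → b < b' → Proper x → 0 < proj₂ x' → step b' x' <F step b x
  larger-quotient-smaller′ {b} {b'} {p , q} {p' , suc q'} b<b' p<q z<s = begin-strict
    Q' * (b * q + p)        <⟨ *-monoʳ-< Q' (+-monoʳ-< (b * q) p<q) ⟩
    Q' * (b * q + q)        ≡⟨ expand-unit Q' b q ⟩
    suc b * (q * Q')        ≤⟨ *-monoˡ-≤ (q * Q') b<b' ⟩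
    b' * (q * Q')           ≤⟨ m≤m+n (b' * (q * Q')) (p' * q) ⟩
    b' * (q * Q') + p' * q  ≡⟨ sym (expand q Q' b' p') ⟩
    q * (b' * Q' + p')      ∎
    where
    open ≤-Reasoning
    Q' : ℕ
    Q' = suc q'

module Decoding where

  open Lexicographic
  open ContinuedFractionStep

  open import Data.Bool using (true; false)
  open import Data.Nat using (ℕ; zero; suc; _≤_; _<_; z≤n; s≤s; z<s; s≤s⁻¹)
  open import Data.Nat.Properties
    using (≤-refl; ≤-trans; <-≤-trans; ≤-<-trans; m≤m+n; m≤n⇒m≤1+n; m^n>0; *-identityʳ)
  open import Data.List using ([]; _∷_; length)
  open import Data.Product using (_,_; proj₁; proj₂)
  open import Data.Sum using (_⊎_; inj₁; inj₂)
  open import Relation.Binary.PropositionalEquality using (_≡_; refl; sym; trans; subst)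

  cfI cfII : ℕ → Word → Frac
  cfI  f w = cfPair (parseI f w)
  cfII f w = cfPair (parseII f w)

  parseI-unfold : ∀ f w → allZero w ≡ false → parseI (suc f) w ≡ valueI w ∷ parseII f (restI w)
  parseI-unfold f w nz with allZero w
  parseI-unfold f w refl | false = refl

  parseI-end : ∀ f w → allZero w ≡ true → parseI f w ≡ []
  parseI-end zero    w _ = refl
  parseI-end (suc f) w z with allZero w
  parseI-end (suc f) w refl | true = refl

  valueI-pos : ∀ w → 1 ≤ valueI w
  valueI-pos w = ≤-trans (m^n>0 2 (zeros w)) (m≤m+n _ _)

  valueII-pos : ∀ w → 1 ≤ valueII w
  valueII-pos w = ≤-trans (m^n>0 2 (ones w)) (m≤m+n _ _)

  length-afterLeading : ∀ c w → length (proj₂ (countLeading c w)) ≤ length w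
  length-afterLeading c     []          = z≤n
  length-afterLeading true  (true ∷ w)  = m≤n⇒m≤1+n (length-afterLeading true w)
  length-afterLeading true  (false ∷ w) = ≤-refl
  length-afterLeading false (false ∷ w) = m≤n⇒m≤1+n (length-afterLeading false w)
  length-afterLeading false (true ∷ w)  = ≤-refl

  length-tl : ∀ w → length (tl w) ≤ length w
  length-tl []      = z≤n
  length-tl (_ ∷ w) = m≤n⇒m≤1+n ≤-refl

  length-afterBits : ∀ c l w → length (afterBits c l w) ≤ length w
  length-afterBits c zero    w = ≤-refl
  length-afterBits c (suc l) w = ≤-trans (length-afterBits c l (tl w)) (length-tl w)

  restI-shorter : ∀ w → allZero w ≡ false → length (restI w) < length w
  restI-shorter w nz = ≤-<-trans (length-afterBits true (zeros w) _)
    (<-≤-trans (tl-shorter (afterZeros w) (afterZeros-hd w nz)) (length-afterLeading false w))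
    where
    tl-shorter : ∀ v → hd v ≡ true → length (tl v) < length v
    tl-shorter (_ ∷ v) _ = ≤-refl

  restII-shorter : ∀ b w → length (restII (b ∷ w)) ≤ length w
  restII-shorter b w = ≤-trans (length-afterBits false (ones (b ∷ w)) _) (tl-afterOnes b w)
    where
    tl-afterOnes : ∀ b w → length (tl (afterOnes (b ∷ w))) ≤ length w
    tl-afterOnes true  []      = z≤n
    tl-afterOnes true  (b ∷ w) = m≤n⇒m≤1+n (tl-afterOnes b w)
    tl-afterOnes false w       = ≤-refl

  FuelI : ℕ → Word → Set
  FuelI f w = allZero w ≡ true ⊎ length w < f

  fuelI-nonzero : ∀ {f w} → allZero w ≡ false → FuelI f w → length w < f
  fuelI-nonzero nz (inj₁ z) with () ← trans (sym nz) z
  fuelI-nonzero _  (inj₂ lw<f) = lw<f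

  fuelII-restI : ∀ {f} w → allZero w ≡ false → length w < suc f → length (restI w) < f
  fuelII-restI w nz lw<f = <-≤-trans (restI-shorter w nz) (s≤s⁻¹ lw<f)

  fuelI-restII : ∀ {f} w → length w < suc f → FuelI f (restII w)
  fuelI-restII []      _          = inj₁ refl
  fuelI-restII (b ∷ w) (s≤s lw<f) = inj₂ (≤-<-trans (restII-shorter b w) lw<f)

  mutual
    cfI-proper : ∀ {f w} → FuelI f w → Proper (cfI f w)
    cfI-proper {f} {w} fuel with allZero w in z
    ... | true rewrite parseI-end f w z = z<s
    cfI-proper {suc f} {w} (inj₂ lw<f) | false rewrite parseI-unfold f w z =
      step-proper (cfII f (restI w)) (valueI-pos w) (proj₁ (cfII-inUnit (fuelII-restI w z lw<f)))

    cfII-inUnit : ∀ {f w} → length w < f → InUnit (cfII f w)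
    cfII-inUnit {suc f} {w} lw<f =
      ≤-<-trans z≤n (cfI-proper (fuelI-restII w lw<f)) , step-atMostOne (cfI f (restII w)) (valueII-pos w)

  cfI-positive : ∀ {f w} → allZero w ≡ false → length w < f → 0 < proj₁ (cfI f w)
  cfI-positive {suc f} {w} nz lw<f rewrite parseI-unfold f w nz =
    let p>0 , p≤q = cfII-inUnit (fuelII-restI w nz lw<f) in <-≤-trans p>0 p≤q

  mutual
    cfI-ascending : ∀ {fx fy x y} → x ≺ y → FuelI fx x → length y < fy → cfI fx x <F cfI fy y
    cfI-ascending {fx} {fy} {x} {y} x≺y _ ly with allZero x in zx
    ... | true rewrite parseI-end fx x zx =
      subst (0 <_) (sym (*-identityʳ _)) (cfI-positive (≺-nonzero x≺y) ly)
    cfI-ascending {suc fx} {suc fy} {x} {y} x≺y (inj₂ lx) ly | false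
      rewrite parseI-unfold fx x zx | parseI-unfold fy y (≺-nonzero x≺y)
      with valueI-descending zx x≺y
    ... | inj₁ smaller =
      larger-quotient-smaller {x' = cfII fx (restI x)} smaller (proj₁ (cfII-inUnit restx)) (cfII-inUnit resty)
      where
      restx : length (restI x) < fx
      restx = fuelII-restI x zx lx
      resty : length (restI y) < fy
      resty = fuelII-restI y (≺-nonzero x≺y) ly
    ... | inj₂ (same , rest≺) rewrite same =
      step-antitone (valueI y) {cfII fy (restI y)} {cfII fx (restI x)}
        (cfII-descending rest≺ (fuelII-restI x zx lx) (fuelII-restI y (≺-nonzero x≺y) ly))

    cfII-descending : ∀ {fx fy x y} → x ≺ y → length x < fx → length y < fy → cfII fy y <F cfII fx x
    cfII-descending {suc fx} {suc fy} {x} {y} x≺y lx ly with valueII-ascending x≺y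
    ... | inj₁ smaller =
      larger-quotient-smaller′ {x' = cfI fy (restII y)} smaller
        (cfI-proper (fuelI-restII x lx)) (≤-<-trans z≤n (cfI-proper (fuelI-restII y ly)))
    ... | inj₂ (same , rest≺) rewrite same =
      step-antitone (valueII y) {cfI fx (restII x)} {cfI fy (restII y)}
        (cfI-ascending rest≺ (fuelI-restII x lx) (fuelI-nonzero {w = restII y} (≺-nonzero rest≺) (fuelI-restII y ly)))

module InOrder where

  open Lexicographic

  open import Data.Bool using (true; false)
  open import Data.Nat using (zero; suc; _+_; _^_)
  open import Data.Nat.Tactic.RingSolver using (solve-∀)
  open import Data.List using (List; []; _∷_; _++_; map; length)
  open import Data.List.Properties using (length-++; length-map)
  open import Data.List.Relation.Unary.All as All using (All; []; _∷_)
  import Data.List.Relation.Unary.All.Properties as All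
  open import Data.List.Relation.Unary.AllPairs as AllPairs using (AllPairs; []; _∷_)
  import Data.List.Relation.Unary.AllPairs.Properties as AllPairs
  open import Relation.Binary.PropositionalEquality using (_≡_; refl; cong; cong₂; module ≡-Reasoning)

  infix 4 _⊏_

  _⊏_ : Word → Word → Set
  u ⊏ v = u ++ true ∷ [] ≺ v ++ true ∷ []

  []≺marked : ∀ u → [] ≺ u ++ true ∷ []
  []≺marked []          = here refl refl
  []≺marked (true ∷ u)  = here refl refl
  []≺marked (false ∷ u) = there refl ([]≺marked u)

  left⊏root : ∀ u → false ∷ u ⊏ []
  left⊏root u = here refl refl

  root⊏right : ∀ u → [] ⊏ true ∷ u
  root⊏right u = there refl ([]≺marked u)

  left⊏right : ∀ u v → false ∷ u ⊏ true ∷ v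
  left⊏right u v = here refl refl

  ⊏-cons : ∀ b {u v} → u ⊏ v → b ∷ u ⊏ b ∷ v
  ⊏-cons b u⊏v = there refl u⊏v

  inorder-sorted : ∀ m → AllPairs _⊏_ (inorder m)
  inorder-sorted zero    = [] ∷ []
  inorder-sorted (suc m) = AllPairs.++⁺ (subtree false) (root<right ∷ subtree true) left<rest
    where
    I : List Word
    I = inorder m
    subtree : ∀ b → AllPairs _⊏_ (map (b ∷_) I)
    subtree b = AllPairs.map⁺ (AllPairs.map (⊏-cons b) (inorder-sorted m))
    root<right : All ([] ⊏_) (map (true ∷_) I)
    root<right = All.map⁺ (All.universal root⊏right I)
    left<rest : All (λ u → All (u ⊏_) ([] ∷ map (true ∷_) I)) (map (false ∷_) I)
    left<rest = All.map⁺ (All.universal left<rest-of I)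
      where
      left<rest-of : ∀ u → All (false ∷ u ⊏_) ([] ∷ map (true ∷_) I)
      left<rest-of u = left⊏root u ∷ All.map⁺ (All.universal (left⊏right u) I)

  length-inorder : ∀ m → length (inorder m) + 1 ≡ 2 ^ suc m
  length-inorder zero    = refl
  length-inorder (suc m) = begin
    length (map (false ∷_) I ++ [] ∷ map (true ∷_) I) + 1
      ≡⟨ cong (_+ 1) (length-++ (map (false ∷_) I)) ⟩
    length (map (false ∷_) I) + suc (length (map (true ∷_) I)) + 1
      ≡⟨ cong₂ (λ l r → l + suc r + 1) (length-map (false ∷_) I) (length-map (true ∷_) I) ⟩
    length I + suc (length I) + 1
      ≡⟨ doubling (length I) ⟩
    (length I + 1) + ((length I + 1) + 0)
      ≡⟨ cong (λ t → t + (t + 0)) (length-inorder m) ⟩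
    2 ^ suc (suc m) ∎
    where
    open ≡-Reasoning
    I : List Word
    I = inorder m
    doubling : ∀ L → L + suc L + 1 ≡ (L + 1) + ((L + 1) + 0)
    doubling = solve-∀

module Labels where

  open ContinuedFractionStep using (Frac; _<F_; Proper)
  open Decoding using (FuelI; cfI; cfI-proper; cfI-ascending)
  open InOrder using (_⊏_; inorder-sorted; length-inorder)

  open import Data.Bool using (true)
  open import Data.Nat using (zero; suc; _+_; _∸_; _^_; _≤_; s≤s; z<s)
  open import Data.Nat.Properties using (m<m+n; m+n∸n≡m)
  open import Data.List using ([]; _∷_; _++_; length)
  open import Data.List.Properties using (length-map)
  open import Data.List.Relation.Unary.Linked as Linked using (Linked; [-]; _∷_)
  import Data.List.Relation.Unary.Linked.Properties as Linked
  open import Data.Product using (proj₁; proj₂; _,_)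
  open import Data.Sum using (inj₂)
  open import Data.Integer as ℤ using (+<+)
  import Data.Integer.Properties as ℤ
  open import Data.Rational as ℚ using (ℚ)
  import Data.Rational.Properties as ℚ
  open import Data.Rational.Unnormalised as ℚᵘ using (mkℚᵘ; *<*)
  import Data.Rational.Unnormalised.Properties as ℚᵘ
  open import Relation.Binary.PropositionalEquality using (sym; subst; subst₂)

  fromℚᵘ-mono-< : ∀ {u v} → u ℚᵘ.< v → ℚ.fromℚᵘ u ℚ.< ℚ.fromℚᵘ v
  fromℚᵘ-mono-< {u} {v} u<v = ℚ.toℚᵘ-cancel-<
    (ℚᵘ.<-respʳ-≃ (ℚᵘ.≃-sym (ℚ.toℚᵘ-fromℚᵘ v)) (ℚᵘ.<-respˡ-≃ (ℚᵘ.≃-sym (ℚ.toℚᵘ-fromℚᵘ u)) u<v))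

  fracℚ-mono : ∀ {x y : Frac} → Proper x → Proper y → x <F y →
    fracℚ (proj₁ x) (proj₂ x) ℚ.< fracℚ (proj₁ y) (proj₂ y)
  fracℚ-mono {p , suc q} {p' , suc q'} _ _ x<y =
    fromℚᵘ-mono-< {mkℚᵘ (ℤ.+ p) q} {mkℚᵘ (ℤ.+ p') q'}
      (*<* (subst₂ ℤ._<_ (ℤ.pos-* p (suc q')) (ℤ.pos-* p' (suc q)) (+<+ x<y)))

  marked-fuel : ∀ u → FuelI (length (u ++ true ∷ []) + 2) (u ++ true ∷ [])
  marked-fuel u = inj₂ (m<m+n _ z<s)

  label-monotone : ∀ {u w} → u ⊏ w → label u ℚ.< label w
  label-monotone {u} {w} u⊏w = fracℚ-mono (cfI-proper (marked-fuel u)) (cfI-proper (marked-fuel w))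
    (cfI-ascending u⊏w (marked-fuel u) (m<m+n _ z<s))

  labels-increasing : ∀ n → Linked ℚ._<_ (labelSeq n)
  labels-increasing n =
    Linked.map⁺ (Linked.map label-monotone (Linked.AllPairs⇒Linked (inorder-sorted (n ∸ 1))))

  nth1-linked : ∀ {R : ℚ → ℚ → Set} {xs} → Linked R xs →
    ∀ j → suc (suc j) ≤ length xs → R (nth1 xs (suc j)) (nth1 xs (suc (suc j)))
  nth1-linked [-]      zero    (s≤s ())
  nth1-linked (r ∷ _)  zero    _             = r
  nth1-linked (_ ∷ rs) (suc j) (s≤s bound) = nth1-linked rs j bound

  successor-in-range : ∀ m k → suc k ≤ 2 ^ suc m ∸ 2 → suc (suc k) ≤ length (labelSeq (suc m))
  successor-in-range m k k+1≤2ⁿ-2 =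
    subst (suc (suc k) ≤_) (sym (length-map label (inorder m)))
      (below (length (inorder m)) (subst (λ t → suc k ≤ t ∸ 2) (sym (length-inorder m)) k+1≤2ⁿ-2))
    where
    below : ∀ L → suc k ≤ L + 1 ∸ 2 → suc (suc k) ≤ L
    below (suc L) k<L = s≤s (subst (suc k ≤_) (m+n∸n≡m L 1) k<L)

module WeightedMediant where

  open import Data.Nat as ℕ using (zero; suc; s≤s; z≤n)
  open import Data.Nat.DivMod using (m/n*n≡m)
  open import Data.Nat.Divisibility using (0∣⇒≡0) renaming (_∣_ to _∣ℕ_)
  open import Data.Nat.GCD using (gcd[m,n]∣m; gcd[m,n]∣n)
  open import Data.Integer using (ℤ; +_; +[1+_]; +<+; 0ℤ; _+_; _-_; _*_; _<_; -_)
  open import Data.Integer.Properties using (pos-*; *-identityˡ; +-inverseʳ; +-monoˡ-<)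
  open import Data.Integer.GCD using (gcd)
  open import Data.Integer.Tactic.RingSolver using (solve-∀)
  open import Data.Rational as ℚ using (ℚ; ↥_; ↧_; *<*)
  open import Data.Product using (_×_; _,_)
  open import Relation.Binary.PropositionalEquality
    using (_≡_; sym; trans; cong; cong₂; subst; module ≡-Reasoning)

  divℤ-exact : ∀ a d → d ∣ℕ suc a →
    (divℤ (+ suc a) (+ d) * + d ≡ + suc a) × (0ℤ < divℤ (+ suc a) (+ d))
  divℤ-exact a zero    0∣a with () ← 0∣⇒≡0 0∣a
  divℤ-exact a (suc d) d∣a with suc a ℕ./ suc d | m/n*n≡m d∣a | *-identityˡ (+ (suc a ℕ./ suc d))
  ... | zero  | () | _
  ... | suc c | c*d≡a | quotient =
    trans (cong (_* + suc d) quotient) (trans (sym (pos-* (suc c) (suc d))) (cong +_ c*d≡a)) ,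
    subst (0ℤ <_) (sym quotient) (+<+ (s≤s z≤n))

  reduce-by-gcd : ∀ A B → 0ℤ < A → 0ℤ < B →
    (divℤ A (gcd A B) * gcd A B ≡ A) × (0ℤ < divℤ A (gcd A B)) ×
    (divℤ B (gcd A B) * gcd A B ≡ B) × (0ℤ < divℤ B (gcd A B))
  reduce-by-gcd (+ zero) _        (+<+ ()) _
  reduce-by-gcd _        (+ zero) _        (+<+ ())
  reduce-by-gcd +[1+ a ] +[1+ b ] _ _ =
    let A-exact , A-pos = divℤ-exact a _ (gcd[m,n]∣m (suc a) (suc b))
        B-exact , B-pos = divℤ-exact b _ (gcd[m,n]∣n (suc a) (suc b))
    in A-exact , A-pos , B-exact , B-pos

  positive-gap : ∀ {i j} → i < j → 0ℤ < j - i
  positive-gap {i} {j} i<j = subst (_< j - i) (+-inverseʳ i) (+-monoˡ-< (- i) i<j)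

  positive-combination : ∀ {a b} → 0ℤ < a → 0ℤ < b → ∀ d d' → 0ℤ < a * + suc d + b * + suc d'
  positive-combination {+[1+ _ ]} {+[1+ _ ]} _        _        _ _ = +<+ (s≤s z≤n)
  positive-combination {+ zero}   {_}        (+<+ ()) _        _ _
  positive-combination {+[1+ _ ]} {+ zero}   _        (+<+ ()) _ _

  -- If g divides the cross differences A = P₂Q₁ - P₁Q₂ and B = P₁Q₀ - P₀Q₁
  -- with quotients a and b, then P₁/Q₁ is the mediant of P₀/Q₀ and P₂/Q₂
  -- with weights a and b, because the difference of the two sides is aB - bA.
  mediant-equation : ∀ P₀ Q₀ P₁ Q₁ P₂ Q₂ a b g →
    a * g ≡ P₂ * Q₁ - P₁ * Q₂ → b * g ≡ P₁ * Q₀ - P₀ * Q₁ →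
    P₁ * (a * Q₀ + b * Q₂) ≡ Q₁ * (a * P₀ + b * P₂)
  mediant-equation P₀ Q₀ P₁ Q₁ P₂ Q₂ a b g ag≡A bg≡B = begin
    P₁ * (a * Q₀ + b * Q₂)
      ≡⟨ difference P₀ Q₀ P₁ Q₁ P₂ Q₂ a b ⟩
    M + (a * (P₁ * Q₀ - P₀ * Q₁) - b * (P₂ * Q₁ - P₁ * Q₂))
      ≡⟨ cong₂ (λ B A → M + (a * B - b * A)) (sym bg≡B) (sym ag≡A) ⟩
    M + (a * (b * g) - b * (a * g))
      ≡⟨ cancel M a b g ⟩
    M ∎
    where
    open ≡-Reasoning
    M : ℤ
    M = Q₁ * (a * P₀ + b * P₂)
    difference : ∀ P₀ Q₀ P₁ Q₁ P₂ Q₂ a b → P₁ * (a * Q₀ + b * Q₂) ≡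
      Q₁ * (a * P₀ + b * P₂) + (a * (P₁ * Q₀ - P₀ * Q₁) - b * (P₂ * Q₁ - P₁ * Q₂))
    difference = solve-∀
    cancel : ∀ X a b g → X + (a * (b * g) - b * (a * g)) ≡ X
    cancel = solve-∀

  weighted-mediant : ∀ (x y z : ℚ) → x ℚ.< y → y ℚ.< z →
    let above = ↥ z * ↧ y - ↥ y * ↧ z
        below = ↥ y * ↧ x - ↥ x * ↧ y
        a     = divℤ above (gcd above below)
        b     = divℤ below (gcd above below)
    in (0ℤ < a * ↧ x + b * ↧ z) × (↥ y * (a * ↧ x + b * ↧ z) ≡ ↧ y * (a * ↥ x + b * ↥ z))
  weighted-mediant x y z (*<* x<y) (*<* y<z) =
    let a-exact , a-pos , b-exact , b-pos = reduce-by-gcd above below (positive-gap y<z) (positive-gap x<y)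
    in positive-combination {a} {b} a-pos b-pos _ _ ,
       mediant-equation (↥ x) (↧ x) (↥ y) (↧ y) (↥ z) (↧ z) a b (gcd above below) a-exact b-exact
    where
    above below a b : ℤ
    above = ↥ z * ↧ y - ↥ y * ↧ z
    below = ↥ y * ↧ x - ↥ x * ↧ y
    a     = divℤ above (gcd above below)
    b     = divℤ below (gcd above below)

open Labels using (labels-increasing; nth1-linked; successor-in-range)
open WeightedMediant using (weighted-mediant)

open import Data.Nat using (ℕ; suc; _≤_; _∸_; _^_; s≤s; z≤n)
open import Data.Nat.Properties using (≤-trans; n≤1+n)
open import Data.Integer using (_+_; _*_; _<_; 0ℤ)
open import Data.Product using (_×_)
open import Data.List using (length)
open import Data.List.Relation.Unary.Linked using (Linked)
open import Data.Rational as ℚ using (ℚ)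
open import Relation.Binary.PropositionalEquality using (_≡_)

-- The entries k - 1, k, k + 1 of the label sequence increase, and Δ⁺, Δ⁻
-- are exactly their cross differences, so weighted-mediant applies.
mainTheorem3 : (n k : ℕ) → 2 ≤ n → 2 ≤ k → k ≤ 2 ^ n ∸ 2 →
    (0ℤ < Δ₊ n k * qk n (k ∸ 1) + Δ₋ n k * qk n (suc k))
    × (pk n k * (Δ₊ n k * qk n (k ∸ 1) + Δ₋ n k * qk n (suc k))
       ≡ qk n k * (Δ₊ n k * pk n (k ∸ 1) + Δ₋ n k * pk n (suc k)))
mainTheorem3 (suc m) (suc (suc j)) _ (s≤s (s≤s z≤n)) k≤2ⁿ-2 =
  weighted-mediant (entry (suc j)) (entry (suc (suc j))) (entry (suc (suc (suc j))))
    (nth1-linked increasing j (≤-trans (n≤1+n _) successor-inside))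
    (nth1-linked increasing (suc j) successor-inside)
  where
  entry : ℕ → ℚ
  entry = nth1 (labelSeq (suc m))
  increasing : Linked ℚ._<_ (labelSeq (suc m))
  increasing = labels-increasing (suc m)
  successor-inside : suc (suc (suc j)) ≤ length (labelSeq (suc m))
  successor-inside = successor-in-range m (suc j) k≤2ⁿ-2
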